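{- Let $(T,s_T),(T',s_{T'})$ be 3-signed trees, and let $\bar T:=T_1\curlyvee T_2\curlyvee\dots\curlyvee T_n$ and $\bar T':=T'_1\curlyvee\dots\curlyvee T'_m$, where $\{T_i\mid 1\le i\le n\}=\{T'_j\mid1\le j\le m\}=\{T,T'\}$. Suppose one of the following holds: (I) $T\curlyvee T'\approx_L T$ and $T_1=T'_1=T$; (II) $T\curlyvee T'\approx_L T'$. Then $\bar T^+\approx_L(\bar T')^+$.
   Context: Trees: a tree is a nonempty finite $T\subseteq\omega^{<\omega}$ closed under initial segments, root $\emptyset$, $\sigma*x$ is $\sigma$ extended by $x$; standard labelling: with $w(T;\sigma)$ the number of children of $\sigma$, $\sigma*x\in T$ iff $x<w(T;\sigma)$, children ordered by $x$. $\pi(\sigma)$ is the parent of a non-root $\sigma$. A 3-signed tree (3ST) is $(T,s_T)$ with $s_T:T\to\{+,-,0\}$ and $s_T(\sigma)=0$ iff $\sigma$ is the root or a leaf. Join: $(T,s_T)\curlyvee(T',s_{T'})$ is the 3ST obtained from the disjoint union by identifying the two roots, the child subtrees of the root of $T'$ being placed after those of $T$ (iterated joins are taken left to right; the operation is associative). For a 3ST $T$, $T^+$ is the 3ST obtained by giving the root of $T$ the sign $+$ and then adding a new root of sign $0$ whose only child is the old root. Moves: let $\sigma$ be a non-root non-leaf vertex (so $s_T(\sigma)\ne0$) with child subtrees $S_0,\dots,S_{n-1}$ in order. $\mathsf{EXUDE}((T,s_T);\sigma)$: if $s_T(\sigma)=+$, reorder the child subtrees of $\sigma$ as $S_1,\dots,S_{n-1},S_0$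 and insert an additional copy of $S_0$ as a new child subtree of $\pi(\sigma)$ immediately before $\sigma$; if $s_T(\sigma)=-$, reorder them as $S_{n-1},S_0,\dots,S_{n-2}$ and insert an additional copy of $S_{n-1}$ as a new child subtree of $\pi(\sigma)$ immediately after $\sigma$. For $m\ge1$, $m\text{ - }\mathsf{REPL}((T,s_T);\sigma)$ replaces the list of child subtrees of $\sigma$ by $m$ consecutive copies of $S_0,\dots,S_{n-1}$. L-equivalence $\approx_L$ is the equivalence relation on 3STs generated by $T\approx_L\mathsf{EXUDE}(T;\sigma)$ and $T\approx_L m\text{ - }\mathsf{REPL}(T;\sigma)$ for all 3STs $T$, non-root non-leaf $\sigma$ and $m\ge1$. -}

module Defs where

open import Data.Nat using (ℕ; zero; suc; _≤_)
open import Data.List using (List; []; _∷_; _++_; concat)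
open import Data.List.NonEmpty using (List⁺; _∷_; _∷ʳ_; _⁺++⁺_; toList)
open import Relation.Binary.Construct.Closure.Equivalence using (EqClosure)

-- Signs of non-root, non-leaf vertices (those are exactly the vertices
-- with sign + or -; the root and the leaves carry sign 0).
data Sgn : Set where
  plus minus : Sgn

-- A non-root vertex together with its subtree, children ordered left to right.
data SubTree : Set where
  leaf : SubTree
  node : Sgn → List⁺ SubTree → SubTree

-- A 3-signed tree: the root (sign 0) given by the ordered list of its child
-- subtrees (the empty list is the one-vertex tree).
Tree3 : Set
Tree3 = List SubTree

-- Join: identify the roots, child subtrees of T' placed after those of T.
_⋎_ : Tree3 → Tree3 → Tree3
T ⋎ T' = T ++ T'

⋎-list : List Tree3 → Tree3
⋎-list = concat

-- T⁺ : the old root gets sign +, a new root (sign 0) is added above it.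
-- (For the one-vertex tree this is not a 3ST; we use a harmless
--  convention, which is never relevant to the statement.)
_⁺ : Tree3 → Tree3
[] ⁺ = leaf ∷ []
(c ∷ cs) ⁺ = node plus (c ∷ cs) ∷ []

-- m consecutive copies of a nonempty list (used for m ≥ 1).
copies : {A : Set} → ℕ → List⁺ A → List⁺ A
copies zero xs = xs
copies (suc zero) xs = xs
copies (suc (suc k)) xs = xs ⁺++⁺ copies (suc k) xs

-- One move (EXUDE or m-REPL) at some non-root non-leaf vertex σ.
-- `Move F F'` relates ordered lists of sibling subtrees (the children list
-- of some vertex); the move is performed either at a vertex σ of that list
-- (for EXUDE the list is the children list of π(σ)), or deeper inside one
-- of the subtrees.
data Move : List SubTree → List SubTree → Set where
  -- s(σ) = + : children S₀,S₁..S_{n-1} ↦ S₁..S_{n-1},S₀ ; copy of S₀ before σ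
  exude-plus : (xs ys : List SubTree) (c : SubTree) (cs : List SubTree) →
    Move (xs ++ node plus (c ∷ cs) ∷ ys)
         (xs ++ c ∷ node plus (cs ∷ʳ c) ∷ ys)
  -- s(σ) = - : children S₀..S_{n-2},S_{n-1} ↦ S_{n-1},S₀..S_{n-2} ; copy of S_{n-1} after σ
  exude-minus : (xs ys : List SubTree) (cs : List SubTree) (l : SubTree) →
    Move (xs ++ node minus (cs ∷ʳ l) ∷ ys)
         (xs ++ node minus (l ∷ cs) ∷ l ∷ ys)
  repl : (xs ys : List SubTree) (s : Sgn) (cs : List⁺ SubTree) (m : ℕ) → 1 ≤ m →
    Move (xs ++ node s cs ∷ ys)
         (xs ++ node s (copies m cs) ∷ ys)
  deep : (xs ys : List SubTree) (s : Sgn) (cs cs' : List⁺ SubTree) →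
    Move (toList cs) (toList cs') →
    Move (xs ++ node s cs ∷ ys)
         (xs ++ node s cs' ∷ ys)

_≈L_ : Tree3 → Tree3 → Set
_≈L_ = EqClosure Move

{-# OPTIONS --safe #-}
-- Under ⁺ the old root may repeat its children (REPL), so (T ^ (k+1))⁺ ≈ T⁺, and
-- it may push a prefix of its children out to the new root one subtree at a time
-- (EXUDE), so (P ++ W)⁺ ≈ P ++ (W ++ P)⁺.  In case (I) every T' is absorbed by the
-- T to its left, and since the word starts with T only a power of T remains.  In
-- case (II) everything before the first T' is absorbed into it, leaving (T' ++ W)⁺;
-- exuding T' turns this into T' ++ (W ++ T')⁺, where W ++ T' collapses to a power
-- of T' and hence to T'⁺, and exuding T' backwards gives T'⁺.
module Submission where

open import Defs
open import Data.List using (List; head)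
open import Data.List.Relation.Unary.All using (All)
open import Data.List.Membership.Propositional using (_∈_)
open import Data.Maybe using (just)
open import Data.Product using (_×_)
open import Data.Sum using (_⊎_)
open import Relation.Binary.PropositionalEquality using (_≡_)

open import Data.Empty using (⊥-elim)
open import Data.Nat using (ℕ; zero; suc; s≤s; z≤n)
open import Data.List using ([]; _∷_; _++_; concat; [_])
open import Data.List.Properties using (++-assoc; ++-identityʳ; ++-conicalʳ)
open import Data.List.NonEmpty using (List⁺; _∷_; _∷ʳ_; toList)
open import Data.List.Relation.Unary.All using ([]; _∷_)
open import Data.List.Relation.Unary.Any using (here; there)
open import Data.Product using (∃; _,_; proj₁; proj₂)
open import Data.Sum using (inj₁; inj₂)
open import Relation.Binary.PropositionalEquality
  using (_≢_; refl; sym; trans; cong; subst; subst₂)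
open import Relation.Binary.Construct.Closure.Equivalence using (setoid; gmap; return)
open import Relation.Binary.Bundles using (Setoid)

open Setoid (setoid Move)
  using () renaming (refl to ≈-refl; sym to ≈-sym; trans to ≈-trans; reflexive to ≈-reflexive)
open import Relation.Binary.Reasoning.Setoid (setoid Move)

private
  variable
    A B : Tree3

Word : Tree3 → Tree3 → List Tree3 → Set
Word T T' = All (λ X → X ≡ T ⊎ X ≡ T')

_^_ : Tree3 → ℕ → Tree3
T ^ zero  = []
T ^ suc k = T ++ T ^ k

++-∷≢[] : (xs : Tree3) {y : SubTree} {ys : Tree3} → xs ++ y ∷ ys ≢ []
++-∷≢[] xs eq with () ← ++-conicalʳ xs _ eq

Move-ends≢[] : Move A B → A ≢ [] × B ≢ []
Move-ends≢[] (exude-plus xs _ _ _)  = ++-∷≢[] xs , ++-∷≢[] xs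
Move-ends≢[] (exude-minus xs _ _ _) = ++-∷≢[] xs , ++-∷≢[] xs
Move-ends≢[] (repl xs _ _ _ _ _)    = ++-∷≢[] xs , ++-∷≢[] xs
Move-ends≢[] (deep xs _ _ _ _ _)    = ++-∷≢[] xs , ++-∷≢[] xs

Move-++ˡ : (P : Tree3) → Move A B → Move (P ++ A) (P ++ B)
Move-++ˡ P (exude-plus xs ys c cs) =
  subst₂ Move (++-assoc P xs _) (++-assoc P xs _) (exude-plus (P ++ xs) ys c cs)
Move-++ˡ P (exude-minus xs ys cs l) =
  subst₂ Move (++-assoc P xs _) (++-assoc P xs _) (exude-minus (P ++ xs) ys cs l)
Move-++ˡ P (repl xs ys s cs m 1≤m) =
  subst₂ Move (++-assoc P xs _) (++-assoc P xs _) (repl (P ++ xs) ys s cs m 1≤m)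
Move-++ˡ P (deep xs ys s cs cs' mv) =
  subst₂ Move (++-assoc P xs _) (++-assoc P xs _) (deep (P ++ xs) ys s cs cs' mv)

Move-++ʳ : (Q : Tree3) → Move A B → Move (A ++ Q) (B ++ Q)
Move-++ʳ Q (exude-plus xs ys c cs) =
  subst₂ Move (sym (++-assoc xs _ Q)) (sym (++-assoc xs _ Q)) (exude-plus xs (ys ++ Q) c cs)
Move-++ʳ Q (exude-minus xs ys cs l) =
  subst₂ Move (sym (++-assoc xs _ Q)) (sym (++-assoc xs _ Q)) (exude-minus xs (ys ++ Q) cs l)
Move-++ʳ Q (repl xs ys s cs m 1≤m) =
  subst₂ Move (sym (++-assoc xs _ Q)) (sym (++-assoc xs _ Q)) (repl xs (ys ++ Q) s cs m 1≤m)
Move-++ʳ Q (deep xs ys s cs cs' mv) =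
  subst₂ Move (sym (++-assoc xs _ Q)) (sym (++-assoc xs _ Q)) (deep xs (ys ++ Q) s cs cs' mv)

Move-⁺ : Move A B → Move (A ⁺) (B ⁺)
Move-⁺ {[]}              mv = ⊥-elim (proj₁ (Move-ends≢[] mv) refl)
Move-⁺ {_ ∷ _} {[]}      mv = ⊥-elim (proj₂ (Move-ends≢[] mv) refl)
Move-⁺ {a ∷ as} {b ∷ bs} mv = deep [] [] plus (a ∷ as) (b ∷ bs) mv

++-congˡ : (P : Tree3) → A ≈L B → (P ++ A) ≈L (P ++ B)
++-congˡ P = gmap (P ++_) (Move-++ˡ P)

++-congʳ : (Q : Tree3) → A ≈L B → (A ++ Q) ≈L (B ++ Q)
++-congʳ Q = gmap (_++ Q) (Move-++ʳ Q)

⁺-cong : A ≈L B → (A ⁺) ≈L (B ⁺)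
⁺-cong = gmap _⁺ Move-⁺

node-plus≡⁺ : (xs : List⁺ SubTree) → node plus xs ∷ [] ≡ toList xs ⁺
node-plus≡⁺ (_ ∷ _) = refl

toList-∷ʳ : (xs : Tree3) (c : SubTree) → toList (xs ∷ʳ c) ≡ xs ++ [ c ]
toList-∷ʳ []      c = refl
toList-∷ʳ (_ ∷ _) c = refl

toList-copies : (k : ℕ) (xs : List⁺ SubTree) → toList (copies (suc k) xs) ≡ toList xs ^ suc k
toList-copies zero    xs = sym (++-identityʳ (toList xs))
toList-copies (suc k) xs = cong (toList xs ++_) (toList-copies k xs)

^-⁺ : (k : ℕ) (T : Tree3) → ((T ^ suc k) ⁺) ≈L (T ⁺)
^-⁺ zero    []       = ≈-refl
^-⁺ (suc k) []       = ^-⁺ k []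
^-⁺ k       (t ∷ ts) = ≈-sym (return (subst (Move ((t ∷ ts) ⁺)) copies≡^
                                             (repl [] [] plus (t ∷ ts) (suc k) (s≤s z≤n))))
  where
  copies≡^ : node plus (copies (suc k) (t ∷ ts)) ∷ [] ≡ ((t ∷ ts) ^ suc k) ⁺
  copies≡^ = trans (node-plus≡⁺ _) (cong _⁺ (toList-copies k (t ∷ ts)))

⁺-exude : (P W : Tree3) → ((P ++ W) ⁺) ≈L (P ++ (W ++ P) ⁺)
⁺-exude []      W = ≈-reflexive (cong _⁺ (sym (++-identityʳ W)))
⁺-exude (c ∷ P) W = begin
  (c ∷ P ++ W) ⁺                      ≈⟨ return (exude-plus [] [] c (P ++ W)) ⟩
  c ∷ node plus ((P ++ W) ∷ʳ c) ∷ [] ≡⟨ cong (c ∷_) (node-plus≡⁺ ((P ++ W) ∷ʳ c)) ⟩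
  c ∷ toList ((P ++ W) ∷ʳ c) ⁺        ≡⟨ cong (λ Z → c ∷ Z ⁺) (toList-∷ʳ (P ++ W) c) ⟩
  c ∷ ((P ++ W) ++ [ c ]) ⁺           ≡⟨ cong (λ Z → c ∷ Z ⁺) (++-assoc P W [ c ]) ⟩
  c ∷ (P ++ W ++ [ c ]) ⁺             ≈⟨ ++-congˡ [ c ] (⁺-exude P (W ++ [ c ])) ⟩
  c ∷ P ++ ((W ++ [ c ]) ++ P) ⁺      ≡⟨ cong (λ Z → c ∷ P ++ Z ⁺) (++-assoc W [ c ] P) ⟩
  c ∷ P ++ (W ++ c ∷ P) ⁺             ∎

module AbsorbRight {T T' : Tree3} (T⋎T'≈T : (T ⋎ T') ≈L T) where

  ++-concat≈^ : (R : List Tree3) → Word T T' R → ∃ λ k → (T ++ concat R) ≈L (T ^ suc k)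
  ++-concat≈^ []      []              = 0 , ≈-refl
  ++-concat≈^ (_ ∷ R) (inj₁ refl ∷ w) with k , e ← ++-concat≈^ R w = suc k , ++-congˡ T e
  ++-concat≈^ (_ ∷ R) (inj₂ refl ∷ w) with k , e ← ++-concat≈^ R w = k , (begin
    T ++ T' ++ concat R   ≡⟨ ++-assoc T T' (concat R) ⟨
    (T ++ T') ++ concat R ≈⟨ ++-congʳ (concat R) T⋎T'≈T ⟩
    T ++ concat R         ≈⟨ e ⟩
    T ^ suc k             ∎)

  concat⁺≈⁺ : (Ts : List Tree3) → Word T T' Ts → head Ts ≡ just T → (concat Ts ⁺) ≈L (T ⁺)
  concat⁺≈⁺ (_ ∷ R) (_ ∷ w) refl with k , e ← ++-concat≈^ R w = ≈-trans (⁺-cong e) (^-⁺ k T)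

module AbsorbLeft {T T' : Tree3} (T⋎T'≈T' : (T ⋎ T') ≈L T') where

  concat-++≈^ : (R : List Tree3) → Word T T' R → ∃ λ k → (concat R ++ T') ≈L (T' ^ suc k)
  concat-++≈^ []      []              = 0 , ≈-reflexive (sym (++-identityʳ T'))
  concat-++≈^ (_ ∷ R) (inj₁ refl ∷ w) with k , e ← concat-++≈^ R w = k , (begin
    (T ++ concat R) ++ T' ≡⟨ ++-assoc T (concat R) T' ⟩
    T ++ concat R ++ T'   ≈⟨ ++-congˡ T e ⟩
    T ++ T' ^ suc k       ≡⟨ ++-assoc T T' (T' ^ k) ⟨
    (T ++ T') ++ T' ^ k   ≈⟨ ++-congʳ (T' ^ k) T⋎T'≈T' ⟩
    T' ^ suc k            ∎)
  concat-++≈^ (_ ∷ R) (inj₂ refl ∷ w) with k , e ← concat-++≈^ R w =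
    suc k , ≈-trans (≈-reflexive (++-assoc T' (concat R) T')) (++-congˡ T' e)

  concat≈T'++ : (R : List Tree3) → Word T T' R → T' ∈ R →
                ∃ λ S → Word T T' S × concat R ≈L (T' ++ concat S)
  concat≈T'++ (_ ∷ R) (inj₂ refl ∷ w) _           = R , w , ≈-refl
  concat≈T'++ (_ ∷ R) (inj₁ refl ∷ w) (here refl) = R , w , ≈-refl
  concat≈T'++ (_ ∷ R) (inj₁ refl ∷ w) (there T'∈R)
    with S , wS , e ← concat≈T'++ R w T'∈R = S , wS , (begin
      T ++ concat R          ≈⟨ ++-congˡ T e ⟩
      T ++ T' ++ concat S    ≡⟨ ++-assoc T T' (concat S) ⟨
      (T ++ T') ++ concat S  ≈⟨ ++-congʳ (concat S) T⋎T'≈T' ⟩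
      T' ++ concat S         ∎)

  concat⁺≈⁺ : (Ts : List Tree3) → Word T T' Ts → T' ∈ Ts → (concat Ts ⁺) ≈L (T' ⁺)
  concat⁺≈⁺ Ts w T'∈Ts
    with S , wS , e ← concat≈T'++ Ts w T'∈Ts
    with k , e' ← concat-++≈^ S wS = begin
      concat Ts ⁺              ≈⟨ ⁺-cong e ⟩
      (T' ++ concat S) ⁺       ≈⟨ ⁺-exude T' (concat S) ⟩
      T' ++ (concat S ++ T') ⁺ ≈⟨ ++-congˡ T' (⁺-cong e') ⟩
      T' ++ (T' ^ suc k) ⁺     ≈⟨ ++-congˡ T' (^-⁺ k T') ⟩
      T' ++ T' ⁺               ≈⟨ ⁺-exude T' [] ⟨
      (T' ++ []) ⁺             ≡⟨ cong _⁺ (++-identityʳ T') ⟩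
      T' ⁺                     ∎

proposition9p1 : (T T' : Tree3) (Ts Ts' : List Tree3) →
    All (λ X → X ≡ T ⊎ X ≡ T') Ts → T ∈ Ts → T' ∈ Ts →
    All (λ X → X ≡ T ⊎ X ≡ T') Ts' → T ∈ Ts' → T' ∈ Ts' →
    (((T ⋎ T') ≈L T) × head Ts ≡ just T × head Ts' ≡ just T) ⊎ ((T ⋎ T') ≈L T') →
    (⋎-list Ts ⁺) ≈L (⋎-list Ts' ⁺)
proposition9p1 T T' Ts Ts' w _ _ w' _ _ (inj₁ (h , hd , hd')) =
  ≈-trans (concat⁺≈⁺ Ts w hd) (≈-sym (concat⁺≈⁺ Ts' w' hd'))
  where open AbsorbRight {T} h
proposition9p1 T T' Ts Ts' w _ T'∈Ts w' _ T'∈Ts' (inj₂ h) =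
  ≈-trans (concat⁺≈⁺ Ts w T'∈Ts) (≈-sym (concat⁺≈⁺ Ts' w' T'∈Ts'))
  where open AbsorbLeft {T} h
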